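{- The cut rule is admissible in $\mathsf{GWF_{N_2}}$: for all finite multisets $\Gamma,\Gamma',\Delta,\Delta'$ and every formula $D$, if $\Gamma\Rightarrow D,\Delta$ and $D,\Gamma'\Rightarrow\Delta'$ are derivable in $\mathsf{GWF_{N_2}}$, then $\Gamma,\Gamma'\Rightarrow\Delta,\Delta'$ is derivable in $\mathsf{GWF_{N_2}}$.
   Context: Formulas are built from a countable set of propositional atoms and $\bot$ using $\wedge,\vee,\rightarrow$. Sequents are $\Gamma\Rightarrow\Delta$ with $\Gamma,\Delta$ finite multisets of formulas. The calculus $\mathsf{GWF_{N_2}}$ has the rules ($p$ atomic): (Ax) $p,\Gamma\Rightarrow\Delta,p$; ($\bot_L$) $\bot,\Gamma\Rightarrow\Delta$; ($\wedge_L$) from $A,B,\Gamma\Rightarrow\Delta$ infer $A\wedge B,\Gamma\Rightarrow\Delta$; ($\wedge_R$) from $\Gamma\Rightarrow\Delta,A$ and $\Gamma\Rightarrow\Delta,B$ infer $\Gamma\Rightarrow\Delta,A\wedge B$; ($\vee_L$) from $A,\Gamma\Rightarrow\Delta$ and $B,\Gamma\Rightarrow\Delta$ infer $A\vee B,\Gamma\Rightarrow\Delta$; ($\vee_R$) from $\Gamma\Rightarrow\Delta,A,B$ infer $\Gamma\Rightarrow\Delta,A\vee B$; ($\rightarrow_R$) from $A\Rightarrow B$ infer $\Gamma\Rightarrow A\rightarrow B,\Delta$; ($\rightarrow_{LR_{N_2}}$) from $A\Rightarrow C,B$ and $A,D\Rightarrow B$ infer $\Gamma,C\rightarrow D\Rightarrow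 A\rightarrow B,\Delta$. Derivability uses only these rules, without cut. -}

module Defs where

open import Data.Nat using (ℕ)
open import Data.List using (List; []; _∷_; _++_)
open import Data.List.Relation.Binary.Permutation.Propositional using (_↭_)

data Fm : Set where
  atom : ℕ → Fm
  ⊥'   : Fm
  _∧'_ : Fm → Fm → Fm
  _∨'_ : Fm → Fm → Fm
  _⊃_  : Fm → Fm → Fm

-- Finite multisets are represented by lists; every rule is stated with
-- its conclusion only determined up to permutation (_↭_), so derivability
-- of Γ ⇒ Δ depends only on the multisets underlying Γ and Δ.

infix 3 _⇒_
data _⇒_ : List Fm → List Fm → Set where
  Ax   : ∀ {Γ Δ Γ₀ Δ₀} p → Γ ↭ (atom p ∷ Γ₀) → Δ ↭ (atom p ∷ Δ₀) → Γ ⇒ Δ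
  ⊥L   : ∀ {Γ Δ Γ₀} → Γ ↭ (⊥' ∷ Γ₀) → Γ ⇒ Δ
  ∧L   : ∀ {Γ Δ Γ₀ A B} → Γ ↭ ((A ∧' B) ∷ Γ₀) →
         (A ∷ B ∷ Γ₀) ⇒ Δ → Γ ⇒ Δ
  ∧R   : ∀ {Γ Δ Δ₀ A B} → Δ ↭ ((A ∧' B) ∷ Δ₀) →
         Γ ⇒ (A ∷ Δ₀) → Γ ⇒ (B ∷ Δ₀) → Γ ⇒ Δ
  ∨L   : ∀ {Γ Δ Γ₀ A B} → Γ ↭ ((A ∨' B) ∷ Γ₀) →
         (A ∷ Γ₀) ⇒ Δ → (B ∷ Γ₀) ⇒ Δ → Γ ⇒ Δ
  ∨R   : ∀ {Γ Δ Δ₀ A B} → Δ ↭ ((A ∨' B) ∷ Δ₀) →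
         Γ ⇒ (A ∷ B ∷ Δ₀) → Γ ⇒ Δ
  ⊃R   : ∀ {Γ Δ Δ₀ A B} → Δ ↭ ((A ⊃ B) ∷ Δ₀) →
         (A ∷ []) ⇒ (B ∷ []) → Γ ⇒ Δ
  ⊃LR  : ∀ {Γ Δ Γ₀ Δ₀ A B C D} →
         Γ ↭ ((C ⊃ D) ∷ Γ₀) → Δ ↭ ((A ⊃ B) ∷ Δ₀) →
         (A ∷ []) ⇒ (C ∷ B ∷ []) → (A ∷ D ∷ []) ⇒ (B ∷ []) → Γ ⇒ Δ

{-# OPTIONS --safe #-}
-- Cut is admissible in the context-sharing form (from Γ ⇒ D, Δ and D, Γ ⇒ Δ
-- infer Γ ⇒ Δ), which gives the stated form by weakening; the proof is by
-- induction on D and then on the derivation of the left premise. The ∧ and ∨ rules are invertible,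
-- so when the left premise ends in one of them the right premise is decomposed
-- alike: the cut moves upward or, if D is principal, becomes cuts on its
-- components. If D is principal in Ax, ⊃R or ⊃LR, whose premises do not depend
-- on Δ, the induction continues on the right premise instead. There D is used
-- only as the atom of an axiom, which Γ then also contains, or as the principal
-- implication A ⊃ B of ⊃LR with conclusion A' ⊃ B'. In the latter case the
-- premises A' ⇒ A, B' and A', B ⇒ B' turn each premise A, Θ ⇒ B, Λ of the rule
-- that introduced A ⊃ B on the left into A', Θ ⇒ B', Λ by cuts on A and B, and
-- the same rule then introduces A' ⊃ B'.
module Submission where

open import Defs
open import Data.List using (List; []; _∷_; _++_)
open import Data.List.Relation.Binary.Permutation.Propositional
open import Data.List.Relation.Binary.Permutation.Propositional.Properties
  using (∈-resp-↭; ++⁺ˡ; shift; shifts; drop-∷; ++-comm)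
open import Data.List.Relation.Unary.Any using (here; there)
open import Data.List.Membership.Propositional.Properties using (∈-∃++)
open import Data.Product using (_×_; _,_)
open import Data.Empty using (⊥-elim)
open import Data.Unit using (⊤; tt)
open import Relation.Binary.PropositionalEquality using (_≡_; _≢_; refl)

module _ {a} {A : Set a} where

  data Occurrences (x : A) (xs : List A) (y : A) (ys : List A) : Set a where
    same     : x ≡ y → xs ↭ ys → Occurrences x xs y ys
    distinct : ∀ zs → xs ↭ y ∷ zs → ys ↭ x ∷ zs → Occurrences x xs y ys

  occurrences : ∀ {ws x xs y ys} → ws ↭ x ∷ xs → ws ↭ y ∷ ys → Occurrences x xs y ys
  occurrences p q = compare (↭-trans (↭-sym p) q)
    where
    compare : ∀ {x xs y ys} → x ∷ xs ↭ y ∷ ys → Occurrences x xs y ys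
    compare {x} {y = y} r with ∈-resp-↭ (↭-sym r) (here refl)
    ... | here refl = same refl (drop-∷ r)
    ... | there y∈xs with ∈-∃++ y∈xs
    ...   | hs , ts , refl = distinct (hs ++ ts) (shift y hs ts)
            (drop-∷ (↭-trans (↭-sym r) (↭-trans (prep x (shift y hs ts)) (swap x y refl))))

  ↭-++-under : ∀ (zs : List A) {xs x ys} → xs ↭ x ∷ ys → zs ++ xs ↭ x ∷ zs ++ ys
  ↭-++-under zs {x = x} {ys} p = ↭-trans (++⁺ˡ zs p) (shift x zs ys)

  ↭-prep-under : ∀ (z : A) {xs x ys} → xs ↭ x ∷ ys → z ∷ xs ↭ x ∷ z ∷ ys
  ↭-prep-under z = ↭-++-under (z ∷ [])

  ↭-prep₂-under : ∀ (z w : A) {xs x ys} → xs ↭ x ∷ ys → z ∷ w ∷ xs ↭ x ∷ z ∷ w ∷ ys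
  ↭-prep₂-under z w = ↭-++-under (z ∷ w ∷ [])

⇒-resp-↭ : ∀ {Γ Γ' Δ Δ'} → Γ ↭ Γ' → Δ ↭ Δ' → Γ ⇒ Δ → Γ' ⇒ Δ'
⇒-resp-↭ g h (Ax p a b)      = Ax p (↭-trans (↭-sym g) a) (↭-trans (↭-sym h) b)
⇒-resp-↭ g h (⊥L a)          = ⊥L (↭-trans (↭-sym g) a)
⇒-resp-↭ g h (∧L a d)        = ∧L (↭-trans (↭-sym g) a) (⇒-resp-↭ refl h d)
⇒-resp-↭ g h (∧R a d e)      = ∧R (↭-trans (↭-sym h) a) (⇒-resp-↭ g refl d) (⇒-resp-↭ g refl e)
⇒-resp-↭ g h (∨L a d e)      = ∨L (↭-trans (↭-sym g) a) (⇒-resp-↭ refl h d) (⇒-resp-↭ refl h e)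
⇒-resp-↭ g h (∨R a d)        = ∨R (↭-trans (↭-sym h) a) (⇒-resp-↭ g refl d)
⇒-resp-↭ g h (⊃R a π)        = ⊃R (↭-trans (↭-sym h) a) π
⇒-resp-↭ g h (⊃LR a b π₁ π₂) = ⊃LR (↭-trans (↭-sym g) a) (↭-trans (↭-sym h) b) π₁ π₂

shiftˡ : ∀ Θ Λ {Γ Δ} → Θ ++ Λ ++ Γ ⇒ Δ → Λ ++ Θ ++ Γ ⇒ Δ
shiftˡ Θ Λ = ⇒-resp-↭ (shifts Θ Λ) refl

shiftʳ : ∀ Θ Λ {Γ Δ} → Γ ⇒ Θ ++ Λ ++ Δ → Γ ⇒ Λ ++ Θ ++ Δ
shiftʳ Θ Λ = ⇒-resp-↭ refl (shifts Θ Λ)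

exchangeˡ : ∀ {A B Γ Δ} → A ∷ B ∷ Γ ⇒ Δ → B ∷ A ∷ Γ ⇒ Δ
exchangeˡ = shiftˡ (_ ∷ []) (_ ∷ [])

exchangeʳ : ∀ {A B Γ Δ} → Γ ⇒ A ∷ B ∷ Δ → Γ ⇒ B ∷ A ∷ Δ
exchangeʳ = shiftʳ (_ ∷ []) (_ ∷ [])

weakenˡ : ∀ W {Γ Δ} → Γ ⇒ Δ → W ∷ Γ ⇒ Δ
weakenˡ W (Ax p a b)      = Ax p (↭-prep-under W a) b
weakenˡ W (⊥L a)          = ⊥L (↭-prep-under W a)
weakenˡ W (∧L a d)        = ∧L (↭-prep-under W a) (shiftˡ (W ∷ []) (_ ∷ _ ∷ []) (weakenˡ W d))
weakenˡ W (∧R a d e)      = ∧R a (weakenˡ W d) (weakenˡ W e)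
weakenˡ W (∨L a d e)      = ∨L (↭-prep-under W a) (exchangeˡ (weakenˡ W d)) (exchangeˡ (weakenˡ W e))
weakenˡ W (∨R a d)        = ∨R a (weakenˡ W d)
weakenˡ W (⊃R a π)        = ⊃R a π
weakenˡ W (⊃LR a b π₁ π₂) = ⊃LR (↭-prep-under W a) b π₁ π₂

weakenʳ : ∀ W {Γ Δ} → Γ ⇒ Δ → Γ ⇒ W ∷ Δ
weakenʳ W (Ax p a b)      = Ax p a (↭-prep-under W b)
weakenʳ W (⊥L a)          = ⊥L a
weakenʳ W (∧L a d)        = ∧L a (weakenʳ W d)
weakenʳ W (∧R a d e)      = ∧R (↭-prep-under W a) (exchangeʳ (weakenʳ W d)) (exchangeʳ (weakenʳ W e))
weakenʳ W (∨L a d e)      = ∨L a (weakenʳ W d) (weakenʳ W e)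
weakenʳ W (∨R a d)        = ∨R (↭-prep-under W a) (shiftʳ (W ∷ []) (_ ∷ _ ∷ []) (weakenʳ W d))
weakenʳ W (⊃R a π)        = ⊃R (↭-prep-under W a) π
weakenʳ W (⊃LR a b π₁ π₂) = ⊃LR a (↭-prep-under W b) π₁ π₂

weaken : ∀ Γ' Δ' {Γ Δ} → Γ ⇒ Δ → Γ ++ Γ' ⇒ Δ ++ Δ'
weaken Γ' Δ' d = ⇒-resp-↭ (++-comm Γ' _) (++-comm Δ' _) (weaken-front Γ' Δ' d)
  where
  weaken-front : ∀ Γ' Δ' {Γ Δ} → Γ ⇒ Δ → Γ' ++ Γ ⇒ Δ' ++ Δ
  weaken-front (W ∷ Γ') Δ'       d = weakenˡ W (weaken-front Γ' Δ' d)
  weaken-front []       (W ∷ Δ') d = weakenʳ W (weaken-front [] Δ' d)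
  weaken-front []       []       d = d

∧L-inv : ∀ {A B Γ Γ* Δ} → Γ* ↭ (A ∧' B) ∷ Γ → Γ* ⇒ Δ → A ∷ B ∷ Γ ⇒ Δ
∧L-inv q (Ax p a b) with occurrences q a
... | same () _
... | distinct _ g _ = Ax p (↭-prep₂-under _ _ g) b
∧L-inv q (⊥L a) with occurrences q a
... | same () _
... | distinct _ g _ = ⊥L (↭-prep₂-under _ _ g)
∧L-inv q (∧L a d) with occurrences q a
... | same refl g = ⇒-resp-↭ (prep _ (prep _ (↭-sym g))) refl d
... | distinct _ g h =
      ∧L (↭-prep₂-under _ _ g) (shiftˡ (_ ∷ _ ∷ []) (_ ∷ _ ∷ []) (∧L-inv (↭-prep₂-under _ _ h) d))
∧L-inv q (∨L a d e) with occurrences q a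
... | same () _
... | distinct _ g h = ∨L (↭-prep₂-under _ _ g)
        (shiftˡ (_ ∷ _ ∷ []) (_ ∷ []) (∧L-inv (↭-prep-under _ h) d))
        (shiftˡ (_ ∷ _ ∷ []) (_ ∷ []) (∧L-inv (↭-prep-under _ h) e))
∧L-inv q (∧R a d e) = ∧R a (∧L-inv q d) (∧L-inv q e)
∧L-inv q (∨R a d) = ∨R a (∧L-inv q d)
∧L-inv q (⊃R a π) = ⊃R a π
∧L-inv q (⊃LR a b π₁ π₂) with occurrences q a
... | same () _
... | distinct _ g _ = ⊃LR (↭-prep₂-under _ _ g) b π₁ π₂

∨L-inv : ∀ {A B Γ Γ* Δ} → Γ* ↭ (A ∨' B) ∷ Γ → Γ* ⇒ Δ → (A ∷ Γ ⇒ Δ) × (B ∷ Γ ⇒ Δ)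
∨L-inv q (Ax p a b) with occurrences q a
... | same () _
... | distinct _ g _ = Ax p (↭-prep-under _ g) b , Ax p (↭-prep-under _ g) b
∨L-inv q (⊥L a) with occurrences q a
... | same () _
... | distinct _ g _ = ⊥L (↭-prep-under _ g) , ⊥L (↭-prep-under _ g)
∨L-inv q (∧L a d) with occurrences q a
... | same () _
... | distinct _ g h with ∨L-inv (↭-prep₂-under _ _ h) d
...   | d₁ , d₂ = ∧L (↭-prep-under _ g) (shiftˡ (_ ∷ []) (_ ∷ _ ∷ []) d₁) ,
                  ∧L (↭-prep-under _ g) (shiftˡ (_ ∷ []) (_ ∷ _ ∷ []) d₂)
∨L-inv q (∨L a d e) with occurrences q a
... | same refl g = ⇒-resp-↭ (prep _ (↭-sym g)) refl d , ⇒-resp-↭ (prep _ (↭-sym g)) refl e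
... | distinct _ g h with ∨L-inv (↭-prep-under _ h) d | ∨L-inv (↭-prep-under _ h) e
...   | d₁ , d₂ | e₁ , e₂ = ∨L (↭-prep-under _ g) (exchangeˡ d₁) (exchangeˡ e₁) ,
                            ∨L (↭-prep-under _ g) (exchangeˡ d₂) (exchangeˡ e₂)
∨L-inv q (∧R a d e) with ∨L-inv q d | ∨L-inv q e
... | d₁ , d₂ | e₁ , e₂ = ∧R a d₁ e₁ , ∧R a d₂ e₂
∨L-inv q (∨R a d) with ∨L-inv q d
... | d₁ , d₂ = ∨R a d₁ , ∨R a d₂
∨L-inv q (⊃R a π) = ⊃R a π , ⊃R a π
∨L-inv q (⊃LR a b π₁ π₂) with occurrences q a
... | same () _
... | distinct _ g _ = ⊃LR (↭-prep-under _ g) b π₁ π₂ , ⊃LR (↭-prep-under _ g) b π₁ π₂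

∧R-inv : ∀ {A B Γ Δ Δ*} → Δ* ↭ (A ∧' B) ∷ Δ → Γ ⇒ Δ* → (Γ ⇒ A ∷ Δ) × (Γ ⇒ B ∷ Δ)
∧R-inv q (Ax p a b) with occurrences q b
... | same () _
... | distinct _ g _ = Ax p a (↭-prep-under _ g) , Ax p a (↭-prep-under _ g)
∧R-inv q (⊥L a) = ⊥L a , ⊥L a
∧R-inv q (∧L a d) with ∧R-inv q d
... | d₁ , d₂ = ∧L a d₁ , ∧L a d₂
∧R-inv q (∨L a d e) with ∧R-inv q d | ∧R-inv q e
... | d₁ , d₂ | e₁ , e₂ = ∨L a d₁ e₁ , ∨L a d₂ e₂
∧R-inv q (∧R a d e) with occurrences q a
... | same refl g = ⇒-resp-↭ refl (prep _ (↭-sym g)) d , ⇒-resp-↭ refl (prep _ (↭-sym g)) e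
... | distinct _ g h with ∧R-inv (↭-prep-under _ h) d | ∧R-inv (↭-prep-under _ h) e
...   | d₁ , d₂ | e₁ , e₂ = ∧R (↭-prep-under _ g) (exchangeʳ d₁) (exchangeʳ e₁) ,
                            ∧R (↭-prep-under _ g) (exchangeʳ d₂) (exchangeʳ e₂)
∧R-inv q (∨R a d) with occurrences q a
... | same () _
... | distinct _ g h with ∧R-inv (↭-prep₂-under _ _ h) d
...   | d₁ , d₂ = ∨R (↭-prep-under _ g) (shiftʳ (_ ∷ []) (_ ∷ _ ∷ []) d₁) ,
                  ∨R (↭-prep-under _ g) (shiftʳ (_ ∷ []) (_ ∷ _ ∷ []) d₂)
∧R-inv q (⊃R a π) with occurrences q a
... | same () _
... | distinct _ g _ = ⊃R (↭-prep-under _ g) π , ⊃R (↭-prep-under _ g) π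
∧R-inv q (⊃LR a b π₁ π₂) with occurrences q b
... | same () _
... | distinct _ g _ = ⊃LR a (↭-prep-under _ g) π₁ π₂ , ⊃LR a (↭-prep-under _ g) π₁ π₂

∨R-inv : ∀ {A B Γ Δ Δ*} → Δ* ↭ (A ∨' B) ∷ Δ → Γ ⇒ Δ* → Γ ⇒ A ∷ B ∷ Δ
∨R-inv q (Ax p a b) with occurrences q b
... | same () _
... | distinct _ g _ = Ax p a (↭-prep₂-under _ _ g)
∨R-inv q (⊥L a) = ⊥L a
∨R-inv q (∧L a d) = ∧L a (∨R-inv q d)
∨R-inv q (∨L a d e) = ∨L a (∨R-inv q d) (∨R-inv q e)
∨R-inv q (∧R a d e) with occurrences q a
... | same () _
... | distinct _ g h = ∧R (↭-prep₂-under _ _ g)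
        (shiftʳ (_ ∷ _ ∷ []) (_ ∷ []) (∨R-inv (↭-prep-under _ h) d))
        (shiftʳ (_ ∷ _ ∷ []) (_ ∷ []) (∨R-inv (↭-prep-under _ h) e))
∨R-inv q (∨R a d) with occurrences q a
... | same refl g = ⇒-resp-↭ refl (prep _ (prep _ (↭-sym g))) d
... | distinct _ g h =
      ∨R (↭-prep₂-under _ _ g) (shiftʳ (_ ∷ _ ∷ []) (_ ∷ _ ∷ []) (∨R-inv (↭-prep₂-under _ _ h) d))
∨R-inv q (⊃R a π) with occurrences q a
... | same () _
... | distinct _ g _ = ⊃R (↭-prep₂-under _ _ g) π
∨R-inv q (⊃LR a b π₁ π₂) with occurrences q b
... | same () _
... | distinct _ g _ = ⊃LR a (↭-prep₂-under _ _ g) π₁ π₂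

Cut : Fm → Set
Cut D = ∀ {Γ Δ Δ*} → Δ* ↭ D ∷ Δ → Γ ⇒ Δ* → D ∷ Γ ⇒ Δ → Γ ⇒ Δ

CutOnComponents : Fm → Set
CutOnComponents (A ∧' B) = Cut A × Cut B
CutOnComponents (A ∨' B) = Cut A × Cut B
CutOnComponents (A ⊃ B)  = Cut A × Cut B
CutOnComponents _        = ⊤

-- The ways Γ ⇒ D, Δ can end in a rule with D principal. No premise mentions Δ,
-- so this evidence survives every change of succedent in the right premise.
data PrincipalOnRight (Γ : List Fm) : Fm → Set where
  byAx  : ∀ {p Γ₀} → Γ ↭ atom p ∷ Γ₀ → PrincipalOnRight Γ (atom p)
  by⊃R  : ∀ {A B} → A ∷ [] ⇒ B ∷ [] → PrincipalOnRight Γ (A ⊃ B)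
  by⊃LR : ∀ {A B C D Γ₀} → Γ ↭ (C ⊃ D) ∷ Γ₀ →
          A ∷ [] ⇒ C ∷ B ∷ [] → A ∷ D ∷ [] ⇒ B ∷ [] → PrincipalOnRight Γ (A ⊃ B)

PrincipalOnRight-replace : ∀ Θ {F Γ Γ₀ D} → (∀ {p} → F ≢ atom p) → (∀ {C E} → F ≢ C ⊃ E) →
  Γ ↭ F ∷ Γ₀ → PrincipalOnRight Γ D → PrincipalOnRight (Θ ++ Γ₀) D
PrincipalOnRight-replace Θ ¬atom ¬⊃ g (byAx a) with occurrences g a
... | same F≡p _ = ⊥-elim (¬atom F≡p)
... | distinct _ k _ = byAx (↭-++-under Θ k)
PrincipalOnRight-replace Θ ¬atom ¬⊃ g (by⊃R π) = by⊃R π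
PrincipalOnRight-replace Θ ¬atom ¬⊃ g (by⊃LR a π₁ π₂) with occurrences g a
... | same F≡C⊃E _ = ⊥-elim (¬⊃ F≡C⊃E)
... | distinct _ k _ = by⊃LR (↭-++-under Θ k) π₁ π₂

cut-⊃LR-premises : ∀ {A B A' B' Θ Λ} → Cut A → Cut B →
  A' ∷ [] ⇒ A ∷ B' ∷ [] → A' ∷ B ∷ [] ⇒ B' ∷ [] → A ∷ Θ ⇒ B ∷ Λ → A' ∷ Θ ⇒ B' ∷ Λ
cut-⊃LR-premises {A} {B} {A'} {B'} {Θ} {Λ} cutA cutB d e π =
  cutB refl (cutA (prep A (swap B' B refl)) (weaken Θ (B ∷ Λ) d) π⁺) e⁺
  where
  π⁺ : A ∷ A' ∷ Θ ⇒ B ∷ B' ∷ Λ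
  π⁺ = exchangeˡ (exchangeʳ (weakenʳ B' (weakenˡ A' π)))
  e⁺ : B ∷ A' ∷ Θ ⇒ B' ∷ Λ
  e⁺ = exchangeˡ (weaken Θ Λ e)

cut-⊃-principal : ∀ {A B A' B' Γ Δ Δ₀} → Cut A → Cut B → PrincipalOnRight Γ (A ⊃ B) →
  Δ ↭ (A' ⊃ B') ∷ Δ₀ → A' ∷ [] ⇒ A ∷ B' ∷ [] → A' ∷ B ∷ [] ⇒ B' ∷ [] → Γ ⇒ Δ
cut-⊃-principal cutA cutB (by⊃R π) q d e = ⊃R q (cut-⊃LR-premises cutA cutB d e π)
cut-⊃-principal cutA cutB (by⊃LR a π₁ π₂) q d e =
  ⊃LR a q (exchangeʳ (cut-⊃LR-premises cutA cutB d e (exchangeʳ π₁)))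
          (cut-⊃LR-premises cutA cutB d e π₂)

cut-principalOnRight : ∀ {D Γ Γ* Δ} → CutOnComponents D → PrincipalOnRight Γ D →
  Γ* ↭ D ∷ Γ → Γ* ⇒ Δ → Γ ⇒ Δ
cut-principalOnRight ih c r (Ax q a b) with occurrences r a
cut-principalOnRight ih (byAx a′) r (Ax q a b) | same refl _ = Ax q a′ b
... | distinct _ g _ = Ax q g b
cut-principalOnRight ih c r (⊥L a) with occurrences r a
cut-principalOnRight ih () r (⊥L a) | same refl _
... | distinct _ g _ = ⊥L g
cut-principalOnRight ih c r (∧L a d) with occurrences r a
cut-principalOnRight ih () r (∧L a d) | same refl _
... | distinct _ g h =
      ∧L g (cut-principalOnRight ih (PrincipalOnRight-replace (_ ∷ _ ∷ []) (λ ()) (λ ()) g c)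
                                 (↭-prep₂-under _ _ h) d)
cut-principalOnRight ih c r (∨L a d e) with occurrences r a
cut-principalOnRight ih () r (∨L a d e) | same refl _
... | distinct _ g h =
      ∨L g (cut-principalOnRight ih (PrincipalOnRight-replace (_ ∷ []) (λ ()) (λ ()) g c)
                                 (↭-prep-under _ h) d)
           (cut-principalOnRight ih (PrincipalOnRight-replace (_ ∷ []) (λ ()) (λ ()) g c)
                                 (↭-prep-under _ h) e)
cut-principalOnRight ih c r (∧R a d e) =
  ∧R a (cut-principalOnRight ih c r d) (cut-principalOnRight ih c r e)
cut-principalOnRight ih c r (∨R a d)   = ∨R a (cut-principalOnRight ih c r d)
cut-principalOnRight _  _ _ (⊃R a π)   = ⊃R a π
cut-principalOnRight ih c r (⊃LR a b π₁ π₂) with occurrences r a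
cut-principalOnRight (cutA , cutB) c r (⊃LR a b π₁ π₂) | same refl _ =
  cut-⊃-principal cutA cutB c b π₁ π₂
... | distinct _ g _ = ⊃LR g b π₁ π₂

cut-step : ∀ {D} → CutOnComponents D → Cut D
cut-step ih q (Ax p a b) right with occurrences q b
... | same refl _ = cut-principalOnRight ih (byAx a) refl right
... | distinct _ g _ = Ax p a g
cut-step _ _ (⊥L a) _ = ⊥L a
cut-step {D} ih q (∧L a d) right =
  ∧L a (cut-step ih q d
         (shiftˡ (_ ∷ _ ∷ []) (D ∷ []) (∧L-inv (↭-prep-under D a) right)))
cut-step {D} ih q (∨L a d e) right with ∨L-inv (↭-prep-under D a) right
... | right₁ , right₂ =
      ∨L a (cut-step ih q d (exchangeˡ right₁)) (cut-step ih q e (exchangeˡ right₂))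
cut-step ih q (∧R a d e) right with occurrences q a
cut-step (cutA , cutB) q (∧R {A = A} {B = B} a d e) right | same refl g =
  cutA (prep A (↭-sym g)) d (cutB (prep B (↭-sym g)) (weakenˡ A e) (exchangeˡ (∧L-inv refl right)))
... | distinct _ g h with ∧R-inv g right
...   | right₁ , right₂ =
        ∧R g (cut-step ih (↭-prep-under _ h) d right₁) (cut-step ih (↭-prep-under _ h) e right₂)
cut-step ih q (∨R a d) right with occurrences q a
cut-step (cutA , cutB) q (∨R {A = A} {B = B} a d) right | same refl g with ∨L-inv refl right
... | right₁ , right₂ = cutB refl (cutA (prep A (prep B (↭-sym g))) d (weakenʳ B right₁)) right₂
cut-step ih q (∨R a d) right | distinct _ g h =
  ∨R g (cut-step ih (↭-prep₂-under _ _ h) d (∨R-inv g right))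
cut-step ih q (⊃R a π) right with occurrences q a
... | same refl _ = cut-principalOnRight ih (by⊃R π) refl right
... | distinct _ g _ = ⊃R g π
cut-step ih q (⊃LR a b π₁ π₂) right with occurrences q b
... | same refl _ = cut-principalOnRight ih (by⊃LR a π₁ π₂) refl right
... | distinct _ g _ = ⊃LR a g π₁ π₂

cut : ∀ D → Cut D
cut (atom p) = cut-step {atom p} tt
cut ⊥'       = cut-step {⊥'} tt
cut (A ∧' B) = cut-step {A ∧' B} (cut A , cut B)
cut (A ∨' B) = cut-step {A ∨' B} (cut A , cut B)
cut (A ⊃ B)  = cut-step {A ⊃ B} (cut A , cut B)

mainTheorem7 : (Γ Γ' Δ Δ' : List Fm) (D : Fm) →
    Γ ⇒ (D ∷ Δ) → (D ∷ Γ') ⇒ Δ' → (Γ ++ Γ') ⇒ (Δ ++ Δ')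
mainTheorem7 Γ Γ' Δ Δ' D left right =
  cut D refl (weaken Γ' Δ' left)
    (⇒-resp-↭ (prep D (++-comm Γ' Γ)) (++-comm Δ' Δ) (weaken Γ Δ right))
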